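{- For every integer $n\ge2$, $\gamma_{tr2}(P_2\square P_n)=\left\lceil\frac{3n}{2}\right\rceil$.
   Context: $P_m$ denotes the directed path with vertex set $\{0,1,\dots,m-1\}$ and arcs $(i,i+1)$ for $0\le i\le m-2$. The Cartesian product $D_1\square D_2$ has vertex set $V(D_1)\times V(D_2)$, with an arc from $(x_1,y_1)$ to $(x_2,y_2)$ iff either $(x_1,x_2)$ is an arc of $D_1$ and $y_1=y_2$, or $x_1=x_2$ and $(y_1,y_2)$ is an arc of $D_2$. For a digraph $D$ and positive integer $k$, a $k$RDF is a function $f:V(D)\to\mathcal{P}(\{1,\dots,k\})$ such that every $v$ with $f(v)=\emptyset$ satisfies $\bigcup_{u\in N^-(v)}f(u)=\{1,\dots,k\}$ ($N^-(v)$ the in-neighbors of $v$); its weight is $\sum_v|f(v)|$. For $D$ with no isolated vertex, a T$k$RDF is a $k$RDF $f$ such that the subdigraph induced by $\{v:f(v)\neq\emptyset\}$ has no isolated vertex (a vertex with no in- or out-neighbors in it); $\gamma_{trk}(D)$ is the minimum weight of a T$k$RDF. -}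

module Defs where

open import Data.Nat using (ℕ; zero; suc; _+_; _*_; _≤_)
open import Data.Fin using (Fin; remQuot; toℕ)
open import Data.Fin.Subset using (Subset; _∈_; ∣_∣; Empty; Nonempty; ⊥)
open import Data.List using (List; map; allFin)
open import Data.Nat.ListAction using (sum)
open import Data.Product using (_×_; _,_; ∃; Σ-syntax; ∃-syntax)
open import Data.Sum using (_⊎_)
open import Relation.Binary.PropositionalEquality using (_≡_)
open import Level using (0ℓ)

record Digraph : Set₁ where
  field
    order : ℕ
    Arc   : Fin order → Fin order → Set
open Digraph public

P : ℕ → Digraph
P m = record { order = m ; Arc = λ i j → suc (toℕ i) ≡ toℕ j }

-- Cartesian product; vertex (x , y) of V(D₁) × V(D₂) is encoded as
-- combine x y : Fin (order D₁ * order D₂), decoded by remQuot.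
_□_ : Digraph → Digraph → Digraph
D₁ □ D₂ = record
  { order = order D₁ * order D₂
  ; Arc = λ a b → Prod (remQuot (order D₂) a) (remQuot (order D₂) b) }
  where
  Prod : Fin (order D₁) × Fin (order D₂) → Fin (order D₁) × Fin (order D₂) → Set
  Prod (x₁ , y₁) (x₂ , y₂) = (Arc D₁ x₁ x₂ × y₁ ≡ y₂) ⊎ (x₁ ≡ x₂ × Arc D₂ y₁ y₂)

NoIsolated : Digraph → Set
NoIsolated D = ∀ v → ∃[ u ] (Arc D u v ⊎ Arc D v u)

Labeling : Digraph → ℕ → Set
Labeling D k = Fin (order D) → Subset k

weight : (D : Digraph) {k : ℕ} → Labeling D k → ℕ
weight D f = sum (map (λ v → ∣ f v ∣) (allFin (order D)))

IsRDF : (D : Digraph) (k : ℕ) → Labeling D k → Set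
IsRDF D k f = ∀ v → f v ≡ ⊥ → ∀ (i : Fin k) → ∃[ u ] (Arc D u v × i ∈ f u)

IsTRDF : (D : Digraph) (k : ℕ) → Labeling D k → Set
IsTRDF D k f = IsRDF D k f ×
  (∀ v → Nonempty (f v) → ∃[ u ] (Nonempty (f u) × (Arc D u v ⊎ Arc D v u)))

γtr≡ : (D : Digraph) (k : ℕ) → ℕ → Set
γtr≡ D k w = (∃[ f ] (IsTRDF D k f × weight D f ≡ w))
           × (∀ f → IsTRDF D k f → w ≤ weight D f)

-- Write a y and b y for the weights of the vertices (0, y) and (1, y) of P₂ □ Pₙ.  An empty
-- top vertex needs a predecessor carrying both colours, an empty bottom vertex needs both
-- colours among its two in-neighbours, and a nonempty bottom vertex needs a nonempty neighbour.
-- From these local facts every column y with a y + b y ≤ 1 closes a block of two or three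
-- consecutive columns of total weight at least 3 or 5 respectively, so the columns are covered
-- by blocks of average weight at least 3/2 and the weight is at least ⌈3n/2⌉.  Putting {1} on
-- the whole top row and alternating {2}, ∅ along the bottom row attains this bound.
module Submission where

open import Defs
open import Data.Nat
  using (ℕ; zero; suc; _+_; _*_; _≤_; _<_; z≤n; s≤s; _≟_; _≤?_; ⌊_/2⌋; ⌈_/2⌉)
open import Data.Nat.Properties
open import Data.Nat.Induction using (<-rec)
open import Data.Fin using (Fin; zero; suc; toℕ; fromℕ<; inject₁; combine; remQuot; _↑ˡ_; _↑ʳ_)
open import Data.Fin.Properties
  using (toℕ-↑ˡ; toℕ-↑ʳ; toℕ-fromℕ<; toℕ-inject₁; remQuot-combine; combine-remQuot)
open import Data.Fin.Subset using (Subset; _∈_; ∣_∣; Nonempty; ⊥; ⊤; ⁅_⁆; inside; outside)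
open import Data.Fin.Subset.Properties
  using (x∈p⇒∣p-x∣<∣p∣; drop-there; ∣p∣≤∣x∷p∣; p⊆q⇒∣p∣≤∣q∣)
open import Data.Vec using ([]; _∷_; here; there)
open import Data.List using (tabulate)
open import Data.List.Properties using (map-tabulate)
open import Data.Nat.ListAction using (sum)
open import Algebra.Properties.CommutativeMonoid.Sum +-0-commutativeMonoid
  using (sum-syntax; sum-cong-≗; ∑-distrib-+)
open import Data.Product as Product using (_×_; _,_; ∃-syntax; proj₁; proj₂)
open import Data.Sum as Sum using (_⊎_; inj₁; inj₂)
open import Function using (_∘_; id)
open import Relation.Nullary using (yes; no; contradiction)
open import Relation.Binary.PropositionalEquality

extend : {A : Set} {n : ℕ} → A → (Fin n → A) → ℕ → A
extend {n = zero}  d t _       = d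
extend {n = suc n} d t zero    = t zero
extend {n = suc n} d t (suc y) = extend d (t ∘ suc) y

extend-toℕ : {A : Set} {n : ℕ} (d : A) (t : Fin n → A) (i : Fin n) → extend d t (toℕ i) ≡ t i
extend-toℕ d t zero    = refl
extend-toℕ d t (suc i) = extend-toℕ d (t ∘ suc) i

∀-toℕ⇒∀-< : ∀ {n} (Q : ℕ → Set) → (∀ (i : Fin n) → Q (toℕ i)) → ∀ {y} → y < n → Q y
∀-toℕ⇒∀-< Q h y<n = subst Q (toℕ-fromℕ< y<n) (h (fromℕ< y<n))

before : {A : Set} → A → (ℕ → A) → ℕ → A
before d s zero    = d
before d s (suc y) = s y

before-map : {A B : Set} (g : A → B) (d : A) (s : ℕ → A) (y : ℕ) →
  g (before d s y) ≡ before (g d) (g ∘ s) y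
before-map g d s zero    = refl
before-map g d s (suc y) = refl

∣p∣≡0⇒p≡⊥ : ∀ {n} (p : Subset n) → ∣ p ∣ ≡ 0 → p ≡ ⊥
∣p∣≡0⇒p≡⊥ []            _    = refl
∣p∣≡0⇒p≡⊥ (outside ∷ p) ∣p∣≡0 = cong (outside ∷_) (∣p∣≡0⇒p≡⊥ p ∣p∣≡0)

0<∣p∣⇒Nonempty : ∀ {n} (p : Subset n) → 0 < ∣ p ∣ → Nonempty p
0<∣p∣⇒Nonempty (inside  ∷ p) _     = zero , here
0<∣p∣⇒Nonempty (outside ∷ p) 0<∣p∣ = Product.map suc there (0<∣p∣⇒Nonempty p 0<∣p∣)

Nonempty⇒0<∣p∣ : ∀ {n} {p : Subset n} → Nonempty p → 0 < ∣ p ∣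
Nonempty⇒0<∣p∣ (_ , x∈p) = ≤-trans (s≤s z≤n) (x∈p⇒∣p-x∣<∣p∣ x∈p)

covering⇒n≤∣p∣+∣q∣ : ∀ {n} (p q : Subset n) → (∀ i → i ∈ p ⊎ i ∈ q) → n ≤ ∣ p ∣ + ∣ q ∣
covering⇒n≤∣p∣+∣q∣ []      []      _     = z≤n
covering⇒n≤∣p∣+∣q∣ (x ∷ p) (y ∷ q) cover
  with cover zero | covering⇒n≤∣p∣+∣q∣ p q (Sum.map drop-there drop-there ∘ cover ∘ suc)
... | inj₁ here | ih = s≤s (≤-trans ih (+-monoʳ-≤ ∣ p ∣ (∣p∣≤∣x∷p∣ y q)))
... | inj₂ here | ih =
  ≤-trans (s≤s (≤-trans ih (+-monoˡ-≤ ∣ q ∣ (∣p∣≤∣x∷p∣ x p)))) (≤-reflexive (sym (+-suc _ ∣ q ∣)))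

sum-tabulate : ∀ {n} (t : Fin n → ℕ) → sum (tabulate t) ≡ ∑[ i < n ] t i
sum-tabulate {zero}  t = refl
sum-tabulate {suc n} t = cong (t zero +_) (sum-tabulate (t ∘ suc))

weight≡∑ : (D : Digraph) {k : ℕ} (f : Labeling D k) → weight D f ≡ ∑[ v < order D ] ∣ f v ∣
weight≡∑ D f = trans (cong sum (map-tabulate id (∣_∣ ∘ f))) (sum-tabulate (∣_∣ ∘ f))

∑-↑ : ∀ m {l} (t : Fin (m + l) → ℕ) →
  ∑[ i < m + l ] t i ≡ ∑[ i < m ] t (i ↑ˡ l) + ∑[ i < l ] t (m ↑ʳ i)
∑-↑ zero    t = refl
∑-↑ (suc m) t = trans (cong (t zero +_) (∑-↑ m (t ∘ suc))) (sym (+-assoc (t zero) _ _))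

∑-combine : ∀ m {k} (t : Fin (m * k) → ℕ) →
  ∑[ v < m * k ] t v ≡ ∑[ x < m ] ∑[ y < k ] t (combine x y)
∑-combine zero        t = refl
∑-combine (suc m) {k} t =
  trans (∑-↑ k t) (cong (∑[ y < k ] t (y ↑ˡ (m * k)) +_) (∑-combine m (t ∘ (k ↑ʳ_))))

∑-prefix-+ : ∀ (c : ℕ → ℕ) m l →
  ∑[ i < m + l ] c (toℕ i) ≡ ∑[ i < m ] c (toℕ i) + ∑[ i < l ] c (toℕ i + m)
∑-prefix-+ c m l = trans (∑-↑ m (c ∘ toℕ)) (cong₂ _+_
  (sum-cong-≗ {m} (λ i → cong c (toℕ-↑ˡ i l)))
  (sum-cong-≗ {l} (λ i → cong c (trans (toℕ-↑ʳ m i) (+-comm m (toℕ i))))))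

∑-1 : ∀ n → ∑[ i < n ] 1 ≡ n
∑-1 zero    = refl
∑-1 (suc n) = cong suc (∑-1 n)

m≤2n⇒⌈m/2⌉≤n : ∀ {m} n → m ≤ 2 * n → ⌈ m /2⌉ ≤ n
m≤2n⇒⌈m/2⌉≤n {m} n m≤2n = begin
  ⌈ m /2⌉         ≤⟨ ⌈n/2⌉-mono m≤2n ⟩
  ⌈ n + (n + 0) /2⌉ ≡⟨ cong (λ k → ⌈ n + k /2⌉) (+-identityʳ n) ⟩
  ⌈ n + n /2⌉     ≡⟨ n≡⌈n+n/2⌉ n ⟨
  n               ∎
  where open ≤-Reasoning

⌈2m+n/2⌉≡m+⌈n/2⌉ : ∀ m n → ⌈ (m + m) + n /2⌉ ≡ m + ⌈ n /2⌉
⌈2m+n/2⌉≡m+⌈n/2⌉ zero    n = refl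
⌈2m+n/2⌉≡m+⌈n/2⌉ (suc m) n =
  trans (cong (λ k → ⌈ suc k + n /2⌉) (+-suc m m)) (cong suc (⌈2m+n/2⌉≡m+⌈n/2⌉ m n))

⌈3n/2⌉≡n+⌈n/2⌉ : ∀ n → ⌈ 3 * n /2⌉ ≡ n + ⌈ n /2⌉
⌈3n/2⌉≡n+⌈n/2⌉ n = trans (cong ⌈_/2⌉ 3n≡2n+n) (⌈2m+n/2⌉≡m+⌈n/2⌉ n n)
  where
  3n≡2n+n : 3 * n ≡ (n + n) + n
  3n≡2n+n = trans (cong (λ k → n + (n + k)) (+-identityʳ n)) (sym (+-assoc n n n))

*-+-mono-≤ : ∀ p q {m l x y} → p * m ≤ q * x → p * l ≤ q * y → p * (m + l) ≤ q * (x + y)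
*-+-mono-≤ p q {m} {l} {x} {y} pm≤qx pl≤qy = begin
  p * (m + l)     ≡⟨ *-distribˡ-+ p m l ⟩
  p * m + p * l   ≤⟨ +-mono-≤ pm≤qx pl≤qy ⟩
  q * x + q * y   ≡⟨ *-distribˡ-+ q x y ⟨
  q * (x + y)     ∎
  where open ≤-Reasoning

record DenseBlock (p q : ℕ) (c : ℕ → ℕ) (k : ℕ) : Set where
  field
    first length : ℕ
    ends-at      : first + length ≡ suc k
    nonempty     : 0 < length
    dense        : p * length ≤ q * ∑[ i < length ] c (toℕ i + first)

dense-blocks⇒dense : ∀ {p q} {c : ℕ → ℕ} n →
  (∀ {k} → k < n → DenseBlock p q c k) → p * n ≤ q * ∑[ i < n ] c (toℕ i)
dense-blocks⇒dense {p} {q} {c} n block = <-rec (λ m → m ≤ n → Dense m) dense-prefix n ≤-refl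
  where
  Dense : ℕ → Set
  Dense m = p * m ≤ q * ∑[ i < m ] c (toℕ i)

  dense-prefix : ∀ m → (∀ {s} → s < m → s ≤ n → Dense s) → m ≤ n → Dense m
  dense-prefix zero    _  _   = ≤-reflexive (trans (*-zeroʳ p) (sym (*-zeroʳ q)))
  dense-prefix (suc k) ih k<n = subst Dense ends-at (begin
      p * (first + length)
    ≤⟨ *-+-mono-≤ p q prefix dense ⟩
      q * (∑[ i < first ] c (toℕ i) + ∑[ i < length ] c (toℕ i + first))
    ≡⟨ cong (q *_) (∑-prefix-+ c first length) ⟨
      q * ∑[ i < first + length ] c (toℕ i)
    ∎)
    where
    open DenseBlock (block k<n)
    open ≤-Reasoning
    first<suc-k : first < suc k
    first<suc-k = subst (first <_) ends-at (m<m+n first nonempty)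
    prefix : Dense first
    prefix = ih first<suc-k (≤-trans (<⇒≤ first<suc-k) k<n)

module _ {c : ℕ → ℕ} where

  block₁ : ∀ {k} → 2 ≤ c k → DenseBlock 3 2 c k
  block₁ {k} 2≤c = record
    { first = k ; length = 1 ; ends-at = +-comm k 1 ; nonempty = s≤s z≤n
    ; dense = ≤-trans (n≤1+n 3) (*-monoʳ-≤ 2 (subst (2 ≤_) (sym (+-identityʳ (c k))) 2≤c)) }

  block₂ : ∀ {j} → 3 ≤ c j + c (suc j) → DenseBlock 3 2 c (suc j)
  block₂ {j} 3≤c = record
    { first = j ; length = 2 ; ends-at = +-comm j 2 ; nonempty = s≤s z≤n
    ; dense = *-monoʳ-≤ 2 (subst (3 ≤_) (cong (c j +_) (sym (+-identityʳ _))) 3≤c) }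

  block₃ : ∀ {i} → 5 ≤ c i + (c (suc i) + c (suc (suc i))) → DenseBlock 3 2 c (suc (suc i))
  block₃ {i} 5≤c = record
    { first = i ; length = 3 ; ends-at = +-comm i 3 ; nonempty = s≤s z≤n
    ; dense = ≤-trans (n≤1+n 9)
        (*-monoʳ-≤ 2 (subst (5 ≤_) (cong (λ z → c i + (c (suc i) + z)) (sym (+-identityʳ _))) 5≤c)) }

-- a y and b y are the weights of (0, y) and (1, y).
record LocalBounds (n : ℕ) (a b : ℕ → ℕ) : Set where
  field
    top-empty    : ∀ {y} → y < n → a y ≡ 0 → ∃[ x ] (y ≡ suc x × 2 ≤ a x)
    bottom-empty : ∀ {y} → y < n → b y ≡ 0 → 2 ≤ a y + before 0 b y
    bottom-total : ∀ {y} → y < n → 0 < b y → 0 < a y ⊎ 0 < before 0 b y ⊎ 0 < b (suc y)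

0<m⇒m+n≤1⇒m≡1×n≡0 : ∀ {m n} → 0 < m → m + n ≤ 1 → m ≡ 1 × n ≡ 0
0<m⇒m+n≤1⇒m≡1×n≡0 {suc zero}    {zero}  _ _               = refl , refl
0<m⇒m+n≤1⇒m≡1×n≡0 {suc zero}    {suc n} _ (s≤s ())
0<m⇒m+n≤1⇒m≡1×n≡0 {suc (suc m)} {n}     _ (s≤s ())

module _ {n : ℕ} {a b : ℕ → ℕ} (bounds : LocalBounds n a b) where
  open LocalBounds bounds

  private
    c : ℕ → ℕ
    c y = a y + b y

    a≤c : ∀ {y} → a y ≤ c y
    a≤c {y} = m≤m+n (a y) (b y)

    b≤c : ∀ {y} → b y ≤ c y
    b≤c {y} = m≤n+m (b y) (a y)

    0<a⇒0<c : ∀ {y} → 0 < a y → 0 < c y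
    0<a⇒0<c 0<a = ≤-trans 0<a a≤c

    0<b⇒0<c : ∀ {y} → 0 < b y → 0 < c y
    0<b⇒0<c 0<b = ≤-trans 0<b b≤c

  empty-top⇒block : ∀ {k} → k < n → a k ≡ 0 → DenseBlock 3 2 c k
  empty-top⇒block k<n ak≡0 with top-empty k<n ak≡0
  ... | j , refl , 2≤aj with b (suc j) ≟ 0
  ...   | no  bk≢0 = block₂ (+-mono-≤ (≤-trans 2≤aj a≤c) (≤-trans (n≢0⇒n>0 bk≢0) b≤c))
  ...   | yes bk≡0 = block₂ (≤-trans (n≤1+n 3) (≤-trans (+-mono-≤ 2≤aj 2≤bj) (m≤m+n (c j) _)))
    where
    2≤bj : 2 ≤ b j
    2≤bj = subst (λ z → 2 ≤ z + b j) ak≡0 (bottom-empty k<n bk≡0)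

  bottom-dominated-from-left : ∀ {k} → k < n → a k ≡ 1 → b k ≡ 0 → 0 < before 0 b k
  bottom-dominated-from-left {k} k<n ak≡1 bk≡0 =
    ≤-pred (subst (λ z → 2 ≤ z + before 0 b k) ak≡1 (bottom-empty k<n bk≡0))

  after-nonempty-bottom⇒block : ∀ {j} → suc j < n → 0 < b j → 0 < c (suc j) → b (suc j) ≡ 0 →
    DenseBlock 3 2 c (suc j)
  after-nonempty-bottom⇒block {j} k<n 0<bj 0<ck bk≡0 with a j ≟ 0
  ... | no aj≢0 = block₂ (+-mono-≤ (+-mono-≤ (n≢0⇒n>0 aj≢0) 0<bj) 0<ck)
  ... | yes aj≡0 with top-empty (<⇒≤ k<n) aj≡0 | bottom-total (<⇒≤ k<n) 0<bj
  ...   | _ , refl , _    | inj₁ 0<aj        = contradiction (subst (0 <_) aj≡0 0<aj) λ ()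
  ...   | _ , refl , _    | inj₂ (inj₂ 0<bk) = contradiction (subst (0 <_) bk≡0 0<bk) λ ()
  ...   | _ , refl , 2≤ai | inj₂ (inj₁ 0<bi) =
    block₃ (+-mono-≤ (+-mono-≤ 2≤ai 0<bi) (+-mono-≤ (0<b⇒0<c 0<bj) 0<ck))

  unit-top⇒block : ∀ {k} → k < n → a k ≡ 1 → b k ≡ 0 → DenseBlock 3 2 c k
  unit-top⇒block {zero}  k<n ak≡1 bk≡0 = contradiction (bottom-dominated-from-left k<n ak≡1 bk≡0) λ ()
  unit-top⇒block {suc j} k<n ak≡1 bk≡0 = after-nonempty-bottom⇒block k<n
    (bottom-dominated-from-left k<n ak≡1 bk≡0) (0<a⇒0<c (≤-reflexive (sym ak≡1))) bk≡0

  local-bounds⇒block : ∀ {k} → k < n → DenseBlock 3 2 c k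
  local-bounds⇒block {k} k<n with 2 ≤? c k | a k ≟ 0
  ... | yes 2≤ck | _       = block₁ 2≤ck
  ... | no  _    | yes ak≡0 = empty-top⇒block k<n ak≡0
  ... | no  2≰ck | no ak≢0
    with 0<m⇒m+n≤1⇒m≡1×n≡0 (n≢0⇒n>0 ak≢0) (≤-pred (≰⇒> 2≰ck))
  ...   | ak≡1 , bk≡0 = unit-top⇒block k<n ak≡1 bk≡0

data Coordinates {m k : ℕ} : Fin (m * k) → Set where
  coords : (x : Fin m) (y : Fin k) → Coordinates (combine x y)

coordinates : ∀ {m} k (v : Fin (m * k)) → Coordinates v
coordinates {m} k v = subst (Coordinates {m} {k}) (combine-remQuot {m} k v) (coords _ _)

CartesianArc : (D₁ D₂ : Digraph) (u v : Fin (order D₁) × Fin (order D₂)) → Set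
CartesianArc D₁ D₂ (x₁ , y₁) (x₂ , y₂) = (Arc D₁ x₁ x₂ × y₁ ≡ y₂) ⊎ (x₁ ≡ x₂ × Arc D₂ y₁ y₂)

module _ {D₁ D₂ : Digraph} (x : Fin (order D₁)) (y : Fin (order D₂))
         (x′ : Fin (order D₁)) (y′ : Fin (order D₂)) where

  □-arc⁻ : Arc (D₁ □ D₂) (combine x y) (combine x′ y′) → CartesianArc D₁ D₂ (x , y) (x′ , y′)
  □-arc⁻ = subst₂ (CartesianArc D₁ D₂) (remQuot-combine x y) (remQuot-combine x′ y′)

  □-arc⁺ : CartesianArc D₁ D₂ (x , y) (x′ , y′) → Arc (D₁ □ D₂) (combine x y) (combine x′ y′)
  □-arc⁺ = subst₂ (CartesianArc D₁ D₂) (sym (remQuot-combine x y)) (sym (remQuot-combine x′ y′))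

bottom-row : ℕ → Subset 2
bottom-row zero          = ⁅ suc zero ⁆
bottom-row (suc zero)    = ⊥
bottom-row (suc (suc y)) = bottom-row y

bottom-row-gap : ∀ y → bottom-row (suc y) ≡ ⊥ → suc zero ∈ bottom-row y
bottom-row-gap zero          _  = there here
bottom-row-gap (suc zero)    ()
bottom-row-gap (suc (suc y)) gap = bottom-row-gap y gap

∑-bottom-row         : ∀ k → ∑[ i < k ] ∣ bottom-row (toℕ i) ∣ ≡ ⌈ k /2⌉
∑-bottom-row-shifted : ∀ k → ∑[ i < k ] ∣ bottom-row (suc (toℕ i)) ∣ ≡ ⌊ k /2⌋
∑-bottom-row zero            = refl
∑-bottom-row (suc k)         = cong suc (∑-bottom-row-shifted k)
∑-bottom-row-shifted zero    = refl
∑-bottom-row-shifted (suc k) = ∑-bottom-row k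

module Ladder (n : ℕ) where

  D : Digraph
  D = P 2 □ P n

  top bot : Fin n → Fin (order D)
  top = combine {2} zero
  bot = combine {2} (suc zero)

  arc⁻ : ∀ x y x′ y′ → Arc D (combine x y) (combine x′ y′) →
    CartesianArc (P 2) (P n) (x , y) (x′ , y′)
  arc⁻ = □-arc⁻ {P 2} {P n}

  arc⁺ : ∀ x y x′ y′ → CartesianArc (P 2) (P n) (x , y) (x′ , y′) →
    Arc D (combine x y) (combine x′ y′)
  arc⁺ = □-arc⁺ {P 2} {P n}

  top-in : ∀ {u y} → Arc D u (top y) → ∃[ x ] (u ≡ top x × Arc (P n) x y)
  top-in {u} {y} arc with coordinates {2} n u
  ... | coords zero       x with arc⁻ zero x zero y arc
  ...   | inj₁ (() , _)
  ...   | inj₂ (_ , x→y) = x , refl , x→y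
  top-in {u} {y} arc | coords (suc zero) x with arc⁻ (suc zero) x zero y arc
  ...   | inj₁ (() , _)
  ...   | inj₂ (() , _)

  bot-in : ∀ {u y} → Arc D u (bot y) → u ≡ top y ⊎ ∃[ x ] (u ≡ bot x × Arc (P n) x y)
  bot-in {u} {y} arc with coordinates {2} n u
  ... | coords zero       x with arc⁻ zero x (suc zero) y arc
  ...   | inj₁ (_ , refl) = inj₁ refl
  ...   | inj₂ (() , _)
  bot-in {u} {y} arc | coords (suc zero) x with arc⁻ (suc zero) x (suc zero) y arc
  ...   | inj₁ (() , _)
  ...   | inj₂ (_ , x→y) = inj₂ (x , refl , x→y)

  bot-out : ∀ {u y} → Arc D (bot y) u → ∃[ x ] (u ≡ bot x × Arc (P n) y x)
  bot-out {u} {y} arc with coordinates {2} n u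
  ... | coords zero       x with arc⁻ (suc zero) y zero x arc
  ...   | inj₁ (() , _)
  ...   | inj₂ (() , _)
  bot-out {u} {y} arc | coords (suc zero) x with arc⁻ (suc zero) y (suc zero) x arc
  ...   | inj₁ (() , _)
  ...   | inj₂ (_ , y→x) = x , refl , y→x

  weight≡∑columns : (f : Labeling D 2) → weight D f ≡ ∑[ y < n ] (∣ f (top y) ∣ + ∣ f (bot y) ∣)
  weight≡∑columns f = begin
      weight D f
    ≡⟨ weight≡∑ D f ⟩
      ∑[ v < 2 * n ] ∣ f v ∣
    ≡⟨ ∑-combine 2 {n} (∣_∣ ∘ f) ⟩
      ∑[ y < n ] ∣ f (top y) ∣ + (∑[ y < n ] ∣ f (bot y) ∣ + 0)
    ≡⟨ cong (∑[ y < n ] ∣ f (top y) ∣ +_) (+-identityʳ _) ⟩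
      ∑[ y < n ] ∣ f (top y) ∣ + ∑[ y < n ] ∣ f (bot y) ∣
    ≡⟨ ∑-distrib-+ {n} (∣_∣ ∘ f ∘ top) (∣_∣ ∘ f ∘ bot) ⟨
      ∑[ y < n ] (∣ f (top y) ∣ + ∣ f (bot y) ∣)
    ∎
    where open ≡-Reasoning

  module _ {f : Labeling D 2} (trdf : IsTRDF D 2 f) where

    private
      A B : ℕ → Subset 2
      A = extend ⊥ (f ∘ top)
      B = extend ⊥ (f ∘ bot)

      A-top : ∀ i → A (toℕ i) ≡ f (top i)
      A-top = extend-toℕ ⊥ (f ∘ top)

      B-bot : ∀ i → B (toℕ i) ≡ f (bot i)
      B-bot = extend-toℕ ⊥ (f ∘ bot)

    rainbow-top : ∀ i → A (toℕ i) ≡ ⊥ → ∀ colour → ∃[ m ] (toℕ i ≡ suc m × colour ∈ A m)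
    rainbow-top i A≡⊥ colour with proj₁ trdf (top i) (trans (sym (A-top i)) A≡⊥) colour
    ... | _ , arc , colour∈ with top-in arc
    ...   | x , refl , x→i = toℕ x , sym x→i , subst (colour ∈_) (sym (A-top x)) colour∈

    rainbow-bottom : ∀ i → B (toℕ i) ≡ ⊥ →
      ∀ colour → colour ∈ A (toℕ i) ⊎ colour ∈ before ⊥ B (toℕ i)
    rainbow-bottom i B≡⊥ colour with proj₁ trdf (bot i) (trans (sym (B-bot i)) B≡⊥) colour
    ... | _ , arc , colour∈ with bot-in arc
    ...   | inj₁ refl            = inj₁ (subst (colour ∈_) (sym (A-top i)) colour∈)
    ...   | inj₂ (x , refl , x→i) =
      inj₂ (subst (λ z → colour ∈ before ⊥ B z) x→i (subst (colour ∈_) (sym (B-bot x)) colour∈))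

    bottom-neighbour : ∀ i → Nonempty (B (toℕ i)) →
      Nonempty (A (toℕ i)) ⊎ Nonempty (before ⊥ B (toℕ i)) ⊎ Nonempty (B (suc (toℕ i)))
    bottom-neighbour i ne with proj₂ trdf (bot i) (subst Nonempty (B-bot i) ne)
    ... | _ , ne′ , inj₁ arc with bot-in arc
    ...   | inj₁ refl            = inj₁ (subst Nonempty (sym (A-top i)) ne′)
    ...   | inj₂ (x , refl , x→i) =
      inj₂ (inj₁ (subst (λ z → Nonempty (before ⊥ B z)) x→i (subst Nonempty (sym (B-bot x)) ne′)))
    bottom-neighbour i ne | _ , ne′ , inj₂ arc with bot-out arc
    ...   | x , refl , i→x =
      inj₂ (inj₂ (subst (Nonempty ∘ B) (sym i→x) (subst Nonempty (sym (B-bot x)) ne′)))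

    local-bounds : LocalBounds n (∣_∣ ∘ A) (∣_∣ ∘ B)
    local-bounds = record
      { top-empty    = ∀-toℕ⇒∀-< (λ y → ∣ A y ∣ ≡ 0 → ∃[ x ] (y ≡ suc x × 2 ≤ ∣ A x ∣)) top-empty
      ; bottom-empty = ∀-toℕ⇒∀-< (λ y → ∣ B y ∣ ≡ 0 → 2 ≤ ∣ A y ∣ + before 0 (∣_∣ ∘ B) y) bottom-empty
      ; bottom-total = ∀-toℕ⇒∀-< (λ y → 0 < ∣ B y ∣ →
          0 < ∣ A y ∣ ⊎ 0 < before 0 (∣_∣ ∘ B) y ⊎ 0 < ∣ B (suc y) ∣) bottom-total
      }
      where
      top-empty : ∀ i → ∣ A (toℕ i) ∣ ≡ 0 → ∃[ x ] (toℕ i ≡ suc x × 2 ≤ ∣ A x ∣)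
      top-empty i ∣A∣≡0 with rainbow-top i (∣p∣≡0⇒p≡⊥ _ ∣A∣≡0) zero
      ... | m , i≡1+m , _ = m , i≡1+m , p⊆q⇒∣p∣≤∣q∣ {p = ⊤} λ {colour} _ → colour∈A colour
        where
        colour∈A : ∀ colour → colour ∈ A m
        colour∈A colour with rainbow-top i (∣p∣≡0⇒p≡⊥ _ ∣A∣≡0) colour
        ... | m′ , i≡1+m′ , colour∈ =
          subst (λ z → colour ∈ A z) (suc-injective (trans (sym i≡1+m′) i≡1+m)) colour∈

      bottom-empty : ∀ i → ∣ B (toℕ i) ∣ ≡ 0 → 2 ≤ ∣ A (toℕ i) ∣ + before 0 (∣_∣ ∘ B) (toℕ i)
      bottom-empty i ∣B∣≡0 = subst (λ z → 2 ≤ ∣ A (toℕ i) ∣ + z) (before-map ∣_∣ ⊥ B (toℕ i))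
        (covering⇒n≤∣p∣+∣q∣ _ _ (rainbow-bottom i (∣p∣≡0⇒p≡⊥ _ ∣B∣≡0)))

      bottom-total : ∀ i → 0 < ∣ B (toℕ i) ∣ →
        0 < ∣ A (toℕ i) ∣ ⊎ 0 < before 0 (∣_∣ ∘ B) (toℕ i) ⊎ 0 < ∣ B (suc (toℕ i)) ∣
      bottom-total i 0<∣B∣ = Sum.map Nonempty⇒0<∣p∣
        (Sum.map (subst (0 <_) (before-map ∣_∣ ⊥ B (toℕ i)) ∘ Nonempty⇒0<∣p∣) Nonempty⇒0<∣p∣)
        (bottom-neighbour i (0<∣p∣⇒Nonempty _ 0<∣B∣))

    TRDF⇒⌈3n/2⌉≤weight : ⌈ 3 * n /2⌉ ≤ weight D f
    TRDF⇒⌈3n/2⌉≤weight = begin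
        ⌈ 3 * n /2⌉
      ≤⟨ m≤2n⇒⌈m/2⌉≤n _ (dense-blocks⇒dense n (local-bounds⇒block local-bounds)) ⟩
        ∑[ i < n ] (∣ A (toℕ i) ∣ + ∣ B (toℕ i) ∣)
      ≡⟨ sum-cong-≗ {n} (λ i → cong₂ _+_ (cong ∣_∣ (A-top i)) (cong ∣_∣ (B-bot i))) ⟩
        ∑[ i < n ] (∣ f (top i) ∣ + ∣ f (bot i) ∣)
      ≡⟨ weight≡∑columns f ⟨
        weight D f
      ∎
      where open ≤-Reasoning

  zigzag-cell : Fin 2 × Fin n → Subset 2
  zigzag-cell (zero     , y) = ⁅ zero ⁆
  zigzag-cell (suc zero , y) = bottom-row (toℕ y)

  zigzag : Labeling D 2
  zigzag v = zigzag-cell (remQuot n v)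

  zigzag-combine : ∀ x y → zigzag (combine x y) ≡ zigzag-cell (x , y)
  zigzag-combine x y = cong zigzag-cell (remQuot-combine x y)

  zigzag-top-nonempty : ∀ y → Nonempty (zigzag (top y))
  zigzag-top-nonempty y = zero , subst (zero ∈_) (sym (zigzag-combine zero y)) here

  zigzag-isRDF : IsRDF D 2 zigzag
  zigzag-isRDF v with coordinates {2} n v
  ... | coords zero y = λ empty →
    contradiction (trans (sym (zigzag-combine zero y)) empty) λ ()
  ... | coords (suc zero) zero = λ empty →
    contradiction (trans (sym (zigzag-combine (suc zero) zero)) empty) λ ()
  ... | coords (suc zero) (suc y) = λ where
    empty zero → top (suc y) , arc⁺ zero (suc y) (suc zero) (suc y) (inj₁ (refl , refl)) ,
      subst (zero ∈_) (sym (zigzag-combine zero (suc y))) here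
    empty (suc zero) → bot (inject₁ y) ,
      arc⁺ (suc zero) (inject₁ y) (suc zero) (suc y) (inj₂ (refl , cong suc (toℕ-inject₁ y))) ,
      subst (suc zero ∈_) (sym (zigzag-combine (suc zero) (inject₁ y)))
        (subst (λ z → suc zero ∈ bottom-row z) (sym (toℕ-inject₁ y))
          (bottom-row-gap (toℕ y) (trans (sym (zigzag-combine (suc zero) (suc y))) empty)))

  zigzag-isTRDF : 2 ≤ n → IsTRDF D 2 zigzag
  zigzag-isTRDF (s≤s (s≤s z≤n)) = zigzag-isRDF , total
    where
    total : ∀ v → Nonempty (zigzag v) → ∃[ u ] (Nonempty (zigzag u) × (Arc D u v ⊎ Arc D v u))
    total v _ with coordinates {2} n v
    ... | coords zero zero = top (suc zero) , zigzag-top-nonempty (suc zero) ,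
      inj₂ (arc⁺ zero zero zero (suc zero) (inj₂ (refl , refl)))
    ... | coords zero (suc y) = top (inject₁ y) , zigzag-top-nonempty (inject₁ y) ,
      inj₁ (arc⁺ zero (inject₁ y) zero (suc y) (inj₂ (refl , cong suc (toℕ-inject₁ y))))
    ... | coords (suc zero) y = top y , zigzag-top-nonempty y ,
      inj₁ (arc⁺ zero y (suc zero) y (inj₁ (refl , refl)))

  zigzag-weight : weight D zigzag ≡ ⌈ 3 * n /2⌉
  zigzag-weight = begin
      weight D zigzag
    ≡⟨ weight≡∑columns zigzag ⟩
      ∑[ y < n ] (∣ zigzag (top y) ∣ + ∣ zigzag (bot y) ∣)
    ≡⟨ sum-cong-≗ {n} (λ y → cong₂ _+_ (cong ∣_∣ (zigzag-combine zero y))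
                                        (cong ∣_∣ (zigzag-combine (suc zero) y))) ⟩
      ∑[ y < n ] (1 + ∣ bottom-row (toℕ y) ∣)
    ≡⟨ ∑-distrib-+ {n} (λ _ → 1) (∣_∣ ∘ bottom-row ∘ toℕ) ⟩
      ∑[ y < n ] 1 + ∑[ y < n ] ∣ bottom-row (toℕ y) ∣
    ≡⟨ cong₂ _+_ (∑-1 n) (∑-bottom-row n) ⟩
      n + ⌈ n /2⌉
    ≡⟨ ⌈3n/2⌉≡n+⌈n/2⌉ n ⟨
      ⌈ 3 * n /2⌉
    ∎
    where open ≡-Reasoning

proposition4p1 : ∀ (n : ℕ) → 2 ≤ n → γtr≡ (P 2 □ P n) 2 ⌈ 3 * n /2⌉
proposition4p1 n 2≤n = (zigzag , zigzag-isTRDF 2≤n , zigzag-weight) , λ _ → TRDF⇒⌈3n/2⌉≤weight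
  where open Ladder n
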